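{- For integers $n$ and $r$ with $2\le r\le n$, $$\sum_{k=r}^{n}(-q^{r-1})^{k-r}\cdot([k-r]_q)_{k-r}\cdot S_q[n,k]=\sum_{\substack{c_1+c_2+\cdots+c_{r-1}=n-r+1\\ c_i\ge 0}} c_{r-1}\cdot[1]_q^{c_1}[2]_q^{c_2}\cdots[r-2]_q^{c_{r-2}}\cdot[r-1]_q^{c_{r-1}-1},$$ where terms with $c_{r-1}=0$ are interpreted as $0$.
   Context: For $k\ge1$, $[k]_q=1+q+\cdots+q^{k-1}$ and $[0]_q=0$; $x^0=1$. The $q$-lower factorial is $([m]_q)_j=[m]_q[m-1]_q\cdots[m-j+1]_q$ (product of $j$ factors, equal to $1$ when $j=0$). The $q$-Stirling numbers of the second kind are defined by $S_q[n,0]=\delta_{n,0}$, $S_q[0,k]=\delta_{0,k}$ and $S_q[n,k]=S_q[n-1,k-1]+[k]_q S_q[n-1,k]$ for $n,k\ge1$. The sum on the right runs over all tuples $(c_1,\dots,c_{r-1})$ of non-negative integers with the given sum. -}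

module Defs where

open import Data.Nat using (ℕ; zero; suc; _∸_) renaming (_+_ to _+ℕ_)
open import Data.List using (List; []; _∷_; map; concatMap; upTo)
open import Algebra.Bundles using (CommutativeRing)

-- Everything is stated in an arbitrary commutative ring R with an arbitrary
-- element q (this covers the polynomial identity in ℤ[q]).
module QStirling {c ℓ} (R : CommutativeRing c ℓ) where
  open CommutativeRing R

  fromℕ : ℕ → Carrier
  fromℕ zero = 0#
  fromℕ (suc m) = 1# + fromℕ m

  pow : Carrier → ℕ → Carrier
  pow x zero = 1#
  pow x (suc m) = x * pow x m

  qint : Carrier → ℕ → Carrier
  qint q zero = 0#
  qint q (suc k) = 1# + q * qint q k

  qfall : Carrier → ℕ → ℕ → Carrier
  qfall q m zero = 1#
  qfall q m (suc j) = qint q m * qfall q (m ∸ 1) j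

  qS : Carrier → ℕ → ℕ → Carrier
  qS q zero zero = 1#
  qS q zero (suc k) = 0#
  qS q (suc n) zero = 0#
  qS q (suc n) (suc k) = qS q n k + qint q (suc k) * qS q n (suc k)

  sumTo : ℕ → (ℕ → Carrier) → Carrier
  sumTo zero f = f 0
  sumTo (suc m) f = sumTo m f + f (suc m)

  sumList : List Carrier → Carrier
  sumList [] = 0#
  sumList (x ∷ xs) = x + sumList xs

  -- Left-hand side: Σ_{k=r}^{n} (-q^(r-1))^(k-r) ([k-r]_q)_(k-r) S_q[n,k]
  -- (written with k = r + i, i = 0 .. n-r)
  lhs : Carrier → ℕ → ℕ → Carrier
  lhs q n r = sumTo (n ∸ r) λ i →
    pow (- pow q (r ∸ 1)) i * qfall q i i * qS q n (r +ℕ i)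

compositions : ℕ → ℕ → List (List ℕ)
compositions zero zero = [] ∷ []
compositions zero (suc s) = []
compositions (suc m) s =
  concatMap (λ c → map (c ∷_) (compositions m (s ∸ c))) (upTo (suc s))

module QStirlingRHS {c ℓ} (R : CommutativeRing c ℓ) where
  open CommutativeRing R
  open QStirling R

  -- weight i (c_i, ..., c_{r-1}) =
  --   [i]^{c_i} ... [r-2]^{c_{r-2}} · c_{r-1} · [r-1]^{c_{r-1}-1}
  -- (the last entry contributes c_{r-1}·[r-1]^{c_{r-1}-1}, which is 0 when c_{r-1} = 0)
  weight : Carrier → ℕ → List ℕ → Carrier
  weight q i [] = 0#
  weight q i (c ∷ []) = fromℕ c * pow (qint q i) (c ∸ 1)
  weight q i (c ∷ d ∷ cs) = pow (qint q i) c * weight q (suc i) (d ∷ cs)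

  rhs : Carrier → ℕ → ℕ → Carrier
  rhs q n r = sumList (map (weight q 1) (compositions (r ∸ 1) (suc (n ∸ r))))

-- Write m = r − 1, a_i = (−q^m)^i ([i]_q)_i and L_B(n) = Σ_{i ≤ B} a_i S_q[n, m+1+i].
-- Since [m+1+i] = [m] + q^m [i+1] and a_{i+1} = −q^m [i+1] a_i, the Stirling recurrence makes
-- L_B(n+1) − [m] L_B(n) telescope to S_q[n,m] whenever n < m+1+B.  Together with
-- S_q[s+m,m] = h_s([1],…,[m]) this is the recurrence of ∂h_s/∂x_m, the derivative of the
-- complete homogeneous polynomial, at x_j = [j]; expanding that derivative monomial by
-- monomial gives the sum over compositions.
module Submission where

open import Defs
open import Data.Nat using (ℕ; _≤_)
open import Algebra.Bundles using (CommutativeRing)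

open import Data.Nat using (zero; suc; _∸_; _<_; s≤s; z≤n) renaming (_+_ to _+ℕ_)
import Data.Nat.Properties as ℕ
open import Data.List using (List; []; _∷_; map; _++_; concatMap; applyUpTo; upTo)
open import Data.List.Properties using (map-++; map-∘)
open import Data.List.Relation.Unary.All using (All; []; _∷_; universal)
open import Data.List.Relation.Unary.All.Properties using (map⁺; concat⁺)
open import Function using (_∘_; id)
open import Relation.Binary.PropositionalEquality as ≡ using (_≡_)
import Algebra.Properties.CommutativeSemigroup as CommutativeSemigroupProperties
import Algebra.Solver.Ring.NaturalCoefficients.Default as SemiringSolver
import Relation.Binary.Reasoning.Setoid as SetoidReasoning

module Sums {c ℓ} (R : CommutativeRing c ℓ) where
  open CommutativeRing R hiding (zero)
  open QStirling R using (sumTo; sumList)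
  open CommutativeSemigroupProperties +-commutativeSemigroup using (interchange)
  open SetoidReasoning setoid

  sumBelow : ℕ → (ℕ → Carrier) → Carrier
  sumBelow zero    f = 0#
  sumBelow (suc n) f = f 0 + sumBelow n (f ∘ suc)

  sumBelow-cong : ∀ n {f g : ℕ → Carrier} → (∀ i → f i ≈ g i) → sumBelow n f ≈ sumBelow n g
  sumBelow-cong zero    f≈g = refl
  sumBelow-cong (suc n) f≈g = +-cong (f≈g 0) (sumBelow-cong n (f≈g ∘ suc))

  sumBelow-distribˡ : ∀ n y (f : ℕ → Carrier) → y * sumBelow n f ≈ sumBelow n (λ i → y * f i)
  sumBelow-distribˡ zero    y f = zeroʳ y
  sumBelow-distribˡ (suc n) y f =
    trans (distribˡ y _ _) (+-cong refl (sumBelow-distribˡ n y (f ∘ suc)))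

  sumBelow-antidiagonal-last : ∀ s (g : ℕ → ℕ → Carrier) → (∀ i t → g i (suc t) ≈ 0#) →
                               sumBelow (suc s) (λ i → g i (s ∸ i)) ≈ g s 0
  sumBelow-antidiagonal-last zero    g g≈0 = +-identityʳ _
  sumBelow-antidiagonal-last (suc s) g g≈0 =
    trans (+-cong (g≈0 0 s) (sumBelow-antidiagonal-last s (g ∘ suc) (g≈0 ∘ suc))) (+-identityˡ _)

  sumList-++ : ∀ xs ys → sumList (xs ++ ys) ≈ sumList xs + sumList ys
  sumList-++ []       ys = sym (+-identityˡ _)
  sumList-++ (x ∷ xs) ys = trans (+-cong refl (sumList-++ xs ys)) (sym (+-assoc _ _ _))

  module _ {a} {A : Set a} where

    sumList-map-concatMap : ∀ {i} {I : Set i} (w : A → Carrier) (f : I → List A) xs →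
      sumList (map w (concatMap f xs)) ≈ sumList (map (λ i → sumList (map w (f i))) xs)
    sumList-map-concatMap w f []       = refl
    sumList-map-concatMap w f (j ∷ xs) = begin
      sumList (map w (f j ++ concatMap f xs))
        ≡⟨ ≡.cong sumList (map-++ w (f j) (concatMap f xs)) ⟩
      sumList (map w (f j) ++ map w (concatMap f xs))
        ≈⟨ sumList-++ (map w (f j)) _ ⟩
      sumList (map w (f j)) + sumList (map w (concatMap f xs))
        ≈⟨ +-cong refl (sumList-map-concatMap w f xs) ⟩
      sumList (map (λ i → sumList (map w (f i))) (j ∷ xs)) ∎

    sumList-map-cong : ∀ {v w : A → Carrier} {xs} → All (λ x → v x ≈ w x) xs →
                       sumList (map v xs) ≈ sumList (map w xs)
    sumList-map-cong []           = refl
    sumList-map-cong (v≈w ∷ vs≈ws) = +-cong v≈w (sumList-map-cong vs≈ws)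

    sumList-map-distribˡ : ∀ y (w : A → Carrier) xs →
                           y * sumList (map w xs) ≈ sumList (map (λ x → y * w x) xs)
    sumList-map-distribˡ y w []       = zeroʳ y
    sumList-map-distribˡ y w (x ∷ xs) =
      trans (distribˡ y _ _) (+-cong refl (sumList-map-distribˡ y w xs))

  sumList-map-applyUpTo : ∀ (w : ℕ → Carrier) f n →
                          sumList (map w (applyUpTo f n)) ≈ sumBelow n (w ∘ f)
  sumList-map-applyUpTo w f zero    = refl
  sumList-map-applyUpTo w f (suc n) = +-cong refl (sumList-map-applyUpTo w (f ∘ suc) n)

  sumTo-cong : ∀ B {f g : ℕ → Carrier} → (∀ i → f i ≈ g i) → sumTo B f ≈ sumTo B g
  sumTo-cong zero    f≈g = f≈g 0
  sumTo-cong (suc B) f≈g = +-cong (sumTo-cong B f≈g) (f≈g (suc B))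

  sumTo-zero : ∀ B {f : ℕ → Carrier} → (∀ i → f i ≈ 0#) → sumTo B f ≈ 0#
  sumTo-zero zero    f≈0 = f≈0 0
  sumTo-zero (suc B) f≈0 = trans (+-cong (sumTo-zero B f≈0) (f≈0 (suc B))) (+-identityʳ 0#)

  sumTo-+ : ∀ B (f g : ℕ → Carrier) → sumTo B (λ i → f i + g i) ≈ sumTo B f + sumTo B g
  sumTo-+ zero    f g = refl
  sumTo-+ (suc B) f g = trans (+-cong (sumTo-+ B f g) refl) (interchange _ _ _ _)

  sumTo-distribˡ : ∀ B y (f : ℕ → Carrier) → y * sumTo B f ≈ sumTo B (λ i → y * f i)
  sumTo-distribˡ zero    y f = refl
  sumTo-distribˡ (suc B) y f = trans (distribˡ y _ _) (+-cong (sumTo-distribˡ B y f) refl)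

  sumTo-telescope : ∀ B (u v : ℕ → Carrier) → (∀ i → u (suc i) + v i ≈ 0#) →
                    sumTo B (λ i → u i + v i) ≈ u 0 + v B
  sumTo-telescope zero    u v cancel = refl
  sumTo-telescope (suc B) u v cancel = begin
    sumTo B (λ i → u i + v i) + (u (suc B) + v (suc B))
      ≈⟨ +-cong (sumTo-telescope B u v cancel) refl ⟩
    (u 0 + v B) + (u (suc B) + v (suc B))
      ≈⟨ +-assoc (u 0) (v B) _ ⟩
    u 0 + (v B + (u (suc B) + v (suc B)))
      ≈⟨ +-cong refl (sym (+-assoc (v B) _ _)) ⟩
    u 0 + ((v B + u (suc B)) + v (suc B))
      ≈⟨ +-cong refl (+-cong (trans (+-comm _ _) (cancel B)) refl) ⟩
    u 0 + (0# + v (suc B))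
      ≈⟨ +-cong refl (+-identityˡ _) ⟩
    u 0 + v (suc B) ∎

-- h i m s is the complete homogeneous polynomial h_s(x_i, …, x_{i+m−1}), and
-- ∂h i e s its partial derivative with respect to the last variable of h i (suc e) s.
module CompleteHomogeneous {c ℓ} (R : CommutativeRing c ℓ) (x : ℕ → CommutativeRing.Carrier R) where
  open CommutativeRing R hiding (zero)
  open QStirling R using (fromℕ; pow)
  open Sums R using (sumBelow; sumBelow-cong; sumBelow-distribˡ)
  open CommutativeSemigroupProperties +-commutativeSemigroup using (xy∙z≈xz∙y)
  open SemiringSolver commutativeSemiring using (solve; _:=_; _:+_; _:*_)
  open SetoidReasoning setoid

  h : ℕ → ℕ → ℕ → Carrier
  h i zero    zero    = 1#
  h i zero    (suc s) = 0#
  h i (suc m) zero    = 1#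
  h i (suc m) (suc s) = h (suc i) m (suc s) + x i * h i (suc m) s

  ∂h : ℕ → ℕ → ℕ → Carrier
  ∂h i zero    s       = fromℕ s * pow (x i) (s ∸ 1)
  ∂h i (suc e) zero    = ∂h (suc i) e zero
  ∂h i (suc e) (suc s) = ∂h (suc i) e (suc s) + x i * ∂h i (suc e) s

  h-zero : ∀ i m → h i m 0 ≈ 1#
  h-zero i zero    = refl
  h-zero i (suc m) = refl

  h-one : ∀ i s → h i 1 s ≈ pow (x i) s
  h-one i zero    = refl
  h-one i (suc s) = trans (+-identityˡ _) (*-cong refl (h-one i s))

  split-exchange : ∀ a b c d X y → (a + X * b) + y * (c + X * d) ≈ (a + y * c) + X * (b + y * d)
  split-exchange = solve 6 (λ a b c d X y → (a :+ X :* b) :+ y :* (c :+ X :* d)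
                                        := (a :+ y :* c) :+ X :* (b :+ y :* d)) refl

  x-suc-+ : ∀ i m → x (suc i +ℕ m) ≈ x (i +ℕ suc m)
  x-suc-+ i m = reflexive (≡.cong x (≡.sym (ℕ.+-suc i m)))

  h-suc-last : ∀ m i s → h i (suc m) (suc s) ≈ h i m (suc s) + x (i +ℕ m) * h i (suc m) s
  h-suc-last zero    i s rewrite ℕ.+-identityʳ i = refl
  h-suc-last (suc m) i zero = begin
    h (suc i) (suc m) 1 + x i * 1#
      ≈⟨ +-cong (h-suc-last m (suc i) 0) refl ⟩
    (h (suc i) m 1 + x (suc i +ℕ m) * 1#) + x i * 1#
      ≈⟨ xy∙z≈xz∙y _ _ _ ⟩
    (h (suc i) m 1 + x i * 1#) + x (suc i +ℕ m) * 1#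
      ≈⟨ +-cong refl (*-cong (x-suc-+ i m) refl) ⟩
    h i (suc m) 1 + x (i +ℕ suc m) * 1# ∎
  h-suc-last (suc m) i (suc s) = begin
    h (suc i) (suc m) (suc (suc s)) + x i * h i (suc (suc m)) (suc s)
      ≈⟨ +-cong (h-suc-last m (suc i) (suc s)) (*-cong refl (h-suc-last (suc m) i s)) ⟩
    (h (suc i) m (suc (suc s)) + x (suc i +ℕ m) * h (suc i) (suc m) (suc s))
      + x i * (h i (suc m) (suc s) + x (i +ℕ suc m) * h i (suc (suc m)) s)
      ≈⟨ +-cong (+-cong refl (*-cong (x-suc-+ i m) refl)) refl ⟩
    (h (suc i) m (suc (suc s)) + x (i +ℕ suc m) * h (suc i) (suc m) (suc s))
      + x i * (h i (suc m) (suc s) + x (i +ℕ suc m) * h i (suc (suc m)) s)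
      ≈⟨ split-exchange _ _ _ _ _ _ ⟩
    h i (suc m) (suc (suc s)) + x (i +ℕ suc m) * h i (suc (suc m)) (suc s) ∎

  ∂h-zero : ∀ i e → ∂h i e 0 ≈ 0#
  ∂h-zero i zero    = zeroˡ _
  ∂h-zero i (suc e) = ∂h-zero (suc i) e

  fromℕ-suc*pow : ∀ y s → fromℕ (suc s) * pow y s ≈ pow y s + y * (fromℕ s * pow y (s ∸ 1))
  fromℕ-suc*pow y zero = begin
    (1# + 0#) * 1#          ≈⟨ *-identityʳ _ ⟩
    1# + 0#                 ≈⟨ +-cong refl (sym (trans (*-cong refl (zeroˡ 1#)) (zeroʳ y))) ⟩
    1# + y * (0# * 1#)      ∎
  fromℕ-suc*pow y (suc s) = begin
    (1# + k) * (y * p)      ≈⟨ distribʳ _ 1# k ⟩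
    1# * (y * p) + k * (y * p)
      ≈⟨ +-cong (*-identityˡ _) (solve 3 (λ k y p → k :* (y :* p) := y :* (k :* p)) refl k y p) ⟩
    y * p + y * (k * p)     ∎
    where
      k = fromℕ (suc s)
      p = pow y s

  ∂h-suc : ∀ e i s → ∂h i e (suc s) ≈ h i (suc e) s + x (i +ℕ e) * ∂h i e s
  ∂h-suc zero i s rewrite ℕ.+-identityʳ i =
    trans (fromℕ-suc*pow (x i) s) (+-cong (sym (h-one i s)) refl)
  ∂h-suc (suc e) i zero = begin
    ∂h (suc i) e 1 + x i * ∂h i (suc e) 0
      ≈⟨ +-cong (∂h-suc e (suc i) 0) (trans (*-cong refl (∂h-zero i (suc e))) (zeroʳ _)) ⟩
    (h (suc i) (suc e) 0 + x (suc i +ℕ e) * ∂h (suc i) e 0) + 0#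
      ≈⟨ +-identityʳ _ ⟩
    h (suc i) (suc e) 0 + x (suc i +ℕ e) * ∂h (suc i) e 0
      ≈⟨ +-cong (h-zero (suc i) (suc e)) (*-cong (x-suc-+ i e) refl) ⟩
    1# + x (i +ℕ suc e) * ∂h (suc i) e 0 ∎
  ∂h-suc (suc e) i (suc s) = begin
    ∂h (suc i) e (suc (suc s)) + x i * ∂h i (suc e) (suc s)
      ≈⟨ +-cong (∂h-suc e (suc i) (suc s)) (*-cong refl (∂h-suc (suc e) i s)) ⟩
    (h (suc i) (suc e) (suc s) + x (suc i +ℕ e) * ∂h (suc i) e (suc s))
      + x i * (h i (suc (suc e)) s + x (i +ℕ suc e) * ∂h i (suc e) s)
      ≈⟨ +-cong (+-cong refl (*-cong (x-suc-+ i e) refl)) refl ⟩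
    (h (suc i) (suc e) (suc s) + x (i +ℕ suc e) * ∂h (suc i) e (suc s))
      + x i * (h i (suc (suc e)) s + x (i +ℕ suc e) * ∂h i (suc e) s)
      ≈⟨ split-exchange _ _ _ _ _ _ ⟩
    h i (suc (suc e)) (suc s) + x (i +ℕ suc e) * ∂h i (suc e) (suc s) ∎

  ∂h-convolution : ∀ i e s →
    sumBelow (suc s) (λ c → pow (x i) c * ∂h (suc i) e (s ∸ c)) ≈ ∂h i (suc e) s
  ∂h-convolution i e zero    = trans (+-identityʳ _) (*-identityˡ _)
  ∂h-convolution i e (suc s) = +-cong (*-identityˡ _) (begin
    sumBelow (suc s) (λ c → (x i * pow (x i) c) * ∂h (suc i) e (s ∸ c))
      ≈⟨ sumBelow-cong (suc s) (λ c → *-assoc (x i) (pow (x i) c) (∂h (suc i) e (s ∸ c))) ⟩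
    sumBelow (suc s) (λ c → x i * (pow (x i) c * ∂h (suc i) e (s ∸ c)))
      ≈⟨ sumBelow-distribˡ (suc s) (x i) (λ c → pow (x i) c * ∂h (suc i) e (s ∸ c)) ⟨
    x i * sumBelow (suc s) (λ c → pow (x i) c * ∂h (suc i) e (s ∸ c))
      ≈⟨ *-cong refl (∂h-convolution i e s) ⟩
    x i * ∂h i (suc e) s ∎)

module QStirlingIdentity {c ℓ} (R : CommutativeRing c ℓ) (q : CommutativeRing.Carrier R) where
  open CommutativeRing R hiding (zero)
  open QStirling R
  open QStirlingRHS R
  open Sums R
  open CompleteHomogeneous R (qint q)
  open CommutativeSemigroupProperties +-commutativeSemigroup using (xy∙z≈xz∙y)
  open SemiringSolver commutativeSemiring using (solve; _:=_; _:+_; _:*_)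
  open SetoidReasoning setoid

  qint-+ : ∀ a b → qint q (a +ℕ b) ≈ qint q a + pow q a * qint q b
  qint-+ zero    b = sym (trans (+-identityˡ _) (*-identityˡ _))
  qint-+ (suc a) b = begin
    1# + q * qint q (a +ℕ b)
      ≈⟨ +-cong refl (*-cong refl (qint-+ a b)) ⟩
    1# + q * (qint q a + pow q a * qint q b)
      ≈⟨ solve 5 (λ o q u p v → o :+ q :* (u :+ p :* v) := (o :+ q :* u) :+ (q :* p) :* v)
               refl 1# q (qint q a) (pow q a) (qint q b) ⟩
    (1# + q * qint q a) + (q * pow q a) * qint q b ∎

  qS-vanishes : ∀ {n k} → n < k → qS q n k ≈ 0#
  qS-vanishes {zero}  {suc k} _       = refl
  qS-vanishes {suc n} {suc k} (s≤s n<k) =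
    trans (+-cong (qS-vanishes n<k) (trans (*-cong refl (qS-vanishes (ℕ.m≤n⇒m≤1+n n<k))) (zeroʳ _)))
          (+-identityˡ 0#)

  qS-diagonal : ∀ m s → qS q (s +ℕ m) m ≈ h 1 m s
  qS-diagonal zero    zero    = refl
  qS-diagonal zero    (suc s) = refl
  qS-diagonal (suc m) zero    =
    trans (+-cong (trans (qS-diagonal m 0) (h-zero 1 m))
                  (trans (*-cong refl (qS-vanishes (ℕ.n<1+n m))) (zeroʳ _)))
          (+-identityʳ 1#)
  qS-diagonal (suc m) (suc s) = begin
    qS q (s +ℕ suc m) m + qint q (suc m) * qS q (s +ℕ suc m) (suc m)
      ≈⟨ +-cong (trans (reflexive (≡.cong (λ n → qS q n m) (ℕ.+-suc s m))) (qS-diagonal m (suc s)))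
                (*-cong refl (qS-diagonal (suc m) s)) ⟩
    h 1 m (suc s) + qint q (suc m) * h 1 (suc m) s
      ≈⟨ h-suc-last m 1 s ⟨
    h 1 (suc m) (suc s) ∎

  weightSum : ℕ → ℕ → ℕ → Carrier
  weightSum i m s = sumList (map (weight q i) (compositions m s))

  weightSum-suc : ∀ i m s → weightSum i (suc m) s ≈
    sumBelow (suc s) (λ c → sumList (map (weight q i) (map (c ∷_) (compositions m (s ∸ c)))))
  weightSum-suc i m s =
    trans (sumList-map-concatMap (weight q i) prefixed (upTo (suc s)))
          (sumList-map-applyUpTo (λ c → sumList (map (weight q i) (prefixed c))) id (suc s))
    where
      prefixed : ℕ → List (List ℕ)
      prefixed c = map (c ∷_) (compositions m (s ∸ c))

  weight-cons : ∀ i c m s →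
    All (λ cs → weight q i (c ∷ cs) ≈ pow (qint q i) c * weight q (suc i) cs) (compositions (suc m) s)
  weight-cons i c m s =
    concat⁺ (map⁺ {f = λ d → map (d ∷_) (compositions m (s ∸ d))}
                  (universal (λ d → map⁺ {f = d ∷_} (universal (λ _ → refl) _)) (upTo (suc s))))

  weightSum-cons : ∀ i c m s → sumList (map (weight q i) (map (c ∷_) (compositions (suc m) s)))
                                ≈ pow (qint q i) c * weightSum (suc i) (suc m) s
  weightSum-cons i c m s = begin
    sumList (map (weight q i) (map (c ∷_) cs))
      ≡⟨ ≡.cong sumList (map-∘ cs) ⟨
    sumList (map (λ ds → weight q i (c ∷ ds)) cs)
      ≈⟨ sumList-map-cong (weight-cons i c m s) ⟩
    sumList (map (λ ds → pow (qint q i) c * weight q (suc i) ds) cs)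
      ≈⟨ sumList-map-distribˡ (pow (qint q i) c) (weight q (suc i)) cs ⟨
    pow (qint q i) c * weightSum (suc i) (suc m) s ∎
    where cs = compositions (suc m) s

  weightSum≈∂h : ∀ e i s → weightSum i (suc e) s ≈ ∂h i e s
  weightSum≈∂h zero i s =
    trans (weightSum-suc i 0 s)
          (trans (sumBelow-antidiagonal-last s
                    (λ c t → sumList (map (weight q i) (map (c ∷_) (compositions 0 t)))) (λ _ _ → refl))
                 (+-identityʳ _))
  weightSum≈∂h (suc e) i s = begin
    weightSum i (suc (suc e)) s
      ≈⟨ weightSum-suc i (suc e) s ⟩
    sumBelow (suc s) (λ c → sumList (map (weight q i) (map (c ∷_) (compositions (suc e) (s ∸ c)))))
      ≈⟨ sumBelow-cong (suc s) (λ c → trans (weightSum-cons i c e (s ∸ c))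
                                              (*-cong refl (weightSum≈∂h e (suc i) (s ∸ c)))) ⟩
    sumBelow (suc s) (λ c → pow (qint q i) c * ∂h (suc i) e (s ∸ c))
      ≈⟨ ∂h-convolution i e s ⟩
    ∂h i (suc e) s ∎

  module LeftHandSide (m : ℕ) where

    coefficient : ℕ → Carrier
    coefficient i = pow (- pow q m) i * qfall q i i

    term shifted boundary : ℕ → ℕ → Carrier
    term     n i = coefficient i * qS q n (suc m +ℕ i)
    shifted  n i = coefficient i * qS q n (m +ℕ i)
    boundary n i = coefficient i * pow q m * qint q (suc i) * qS q n (suc (m +ℕ i))

    lhsSum : ℕ → ℕ → Carrier
    lhsSum B n = sumTo B (term n)

    term-suc : ∀ n i → term (suc n) i ≈ (shifted n i + boundary n i) + qint q m * term n i
    term-suc n i = begin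
      a * (qS q n (m +ℕ i) + qint q (suc (m +ℕ i)) * W)
        ≈⟨ *-cong refl (+-cong refl (*-cong qint-split refl)) ⟩
      a * (qS q n (m +ℕ i) + (qint q m + pow q m * qint q (suc i)) * W)
        ≈⟨ solve 6 (λ a S xm Q y W → a :* (S :+ (xm :+ Q :* y) :* W)
                                  := (a :* S :+ a :* Q :* y :* W) :+ xm :* (a :* W))
                 refl a (qS q n (m +ℕ i)) (qint q m) (pow q m) (qint q (suc i)) W ⟩
      (shifted n i + boundary n i) + qint q m * (a * W) ∎
      where
        a = coefficient i
        W = qS q n (suc (m +ℕ i))
        qint-split : qint q (suc (m +ℕ i)) ≈ qint q m + pow q m * qint q (suc i)
        qint-split = trans (reflexive (≡.cong (qint q) (≡.sym (ℕ.+-suc m i)))) (qint-+ m (suc i))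

    shifted-boundary-cancel : ∀ n i → shifted n (suc i) + boundary n i ≈ 0#
    shifted-boundary-cancel n i = begin
      (- Q * P) * (y * F) * qS q n (m +ℕ suc i) + P * F * Q * y * W
        ≈⟨ +-cong (*-cong refl (reflexive (≡.cong (qS q n) (ℕ.+-suc m i)))) refl ⟩
      (- Q * P) * (y * F) * W + P * F * Q * y * W
        ≈⟨ solve 6 (λ N Q P F y W → N :* P :* (y :* F) :* W :+ P :* F :* Q :* y :* W
                                 := (N :+ Q) :* (P :* F :* y :* W))
                 refl (- Q) Q P F y W ⟩
      (- Q + Q) * (P * F * y * W)
        ≈⟨ *-cong (-‿inverseˡ Q) refl ⟩
      0# * (P * F * y * W)
        ≈⟨ zeroˡ _ ⟩
      0# ∎
      where
        Q = pow q m
        P = pow (- Q) i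
        F = qfall q i i
        y = qint q (suc i)
        W = qS q n (suc (m +ℕ i))

    lhsSum-suc : ∀ B n → lhsSum B (suc n) ≈ (qS q n m + qint q m * lhsSum B n) + boundary n B
    lhsSum-suc B n = begin
      lhsSum B (suc n)
        ≈⟨ sumTo-cong B (term-suc n) ⟩
      sumTo B (λ i → (shifted n i + boundary n i) + qint q m * term n i)
        ≈⟨ sumTo-+ B _ _ ⟩
      sumTo B (λ i → shifted n i + boundary n i) + sumTo B (λ i → qint q m * term n i)
        ≈⟨ +-cong (sumTo-telescope B (shifted n) (boundary n) (shifted-boundary-cancel n))
                  (sym (sumTo-distribˡ B (qint q m) _)) ⟩
      (shifted n 0 + boundary n B) + qint q m * lhsSum B n
        ≈⟨ +-cong (+-cong shifted-zero refl) refl ⟩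
      (qS q n m + boundary n B) + qint q m * lhsSum B n
        ≈⟨ xy∙z≈xz∙y _ _ _ ⟩
      (qS q n m + qint q m * lhsSum B n) + boundary n B ∎
      where
        shifted-zero : shifted n 0 ≈ qS q n m
        shifted-zero = trans (*-cong (*-identityˡ 1#) refl)
                             (trans (*-identityˡ _) (reflexive (≡.cong (qS q n) (ℕ.+-identityʳ m))))

    lhsSum-suc-below : ∀ B n → n ≤ m +ℕ B → lhsSum B (suc n) ≈ qS q n m + qint q m * lhsSum B n
    lhsSum-suc-below B n n≤m+B =
      trans (lhsSum-suc B n)
            (trans (+-cong refl (trans (*-cong refl (qS-vanishes (s≤s n≤m+B))) (zeroʳ _)))
                   (+-identityʳ _))

    lhsSum-vanishes : ∀ B n → n ≤ m → lhsSum B n ≈ 0#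
    lhsSum-vanishes B n n≤m = sumTo-zero B (λ i →
      trans (*-cong refl (qS-vanishes (s≤s (ℕ.≤-trans n≤m (ℕ.m≤m+n m i))))) (zeroʳ _))

  lhsSum≈∂h : ∀ e B N → N ≤ suc B → LeftHandSide.lhsSum (suc e) B (N +ℕ suc e) ≈ ∂h 1 e N
  lhsSum≈∂h e B zero    _         = trans (lhsSum-vanishes B (suc e) ℕ.≤-refl) (sym (∂h-zero 1 e))
    where open LeftHandSide (suc e)
  lhsSum≈∂h e B (suc N) (s≤s N≤B) = begin
    lhsSum B (suc (N +ℕ suc e))
      ≈⟨ lhsSum-suc-below B (N +ℕ suc e)
           (ℕ.≤-trans (ℕ.≤-reflexive (ℕ.+-comm N (suc e))) (ℕ.+-monoʳ-≤ (suc e) N≤B)) ⟩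
    qS q (N +ℕ suc e) (suc e) + qint q (suc e) * lhsSum B (N +ℕ suc e)
      ≈⟨ +-cong (qS-diagonal (suc e) N) (*-cong refl (lhsSum≈∂h e B N (ℕ.m≤n⇒m≤1+n N≤B))) ⟩
    h 1 (suc e) N + qint q (suc e) * ∂h 1 e N
      ≈⟨ ∂h-suc e 1 N ⟨
    ∂h 1 e (suc N) ∎
    where open LeftHandSide (suc e)

proposition10p3 : ∀ {c ℓ} (R : CommutativeRing c ℓ) (q : CommutativeRing.Carrier R)
                    (n r : ℕ) → 2 ≤ r → r ≤ n →
                    CommutativeRing._≈_ R (QStirling.lhs R q n r) (QStirlingRHS.rhs R q n r)
proposition10p3 R q n r@(suc (suc e)) (s≤s (s≤s z≤n)) r≤n = begin
  lhsSum B n                ≡⟨ ≡.cong (lhsSum B) n≡B+r ⟩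
  lhsSum B (suc B +ℕ suc e) ≈⟨ lhsSum≈∂h e B (suc B) ℕ.≤-refl ⟩
  ∂h 1 e (suc B)            ≈⟨ weightSum≈∂h e 1 (suc B) ⟨
  weightSum 1 (suc e) (suc B) ∎
  where
    open CommutativeRing R using (setoid)
    open SetoidReasoning setoid
    open QStirlingIdentity R q
    open CompleteHomogeneous R (QStirling.qint R q) using (∂h)
    open LeftHandSide (suc e) using (lhsSum)
    B = n ∸ r
    n≡B+r : n ≡ suc B +ℕ suc e
    n≡B+r = ≡.trans (≡.sym (ℕ.m∸n+n≡m r≤n)) (ℕ.+-suc B (suc e))
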